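{- Let $t$ be an $\mathrm{SL}_2$-tiling with enough ones. There exist $(x_\alpha,y_\alpha)\in\mathbb{Z}\times\mathbb{Z}$ for $\alpha\in\mathbb{Z}$ such that: (i) for $(x,y)\in\mathbb{Z}^2$, $t_{xy}=1$ if and only if $(x,y)=(x_\alpha,y_\alpha)$ for some $\alpha$; (ii) for each $\alpha$, either (a) $x_{\alpha+1}<x_\alpha$ and $y_{\alpha+1}=y_\alpha$, or (b) $x_{\alpha+1}=x_\alpha$ and $y_{\alpha+1}>y_\alpha$; (iii) as $\alpha\to\infty$ and as $\alpha\to-\infty$ there are infinitely many shifts between options (a) and (b), i.e. for every $N$ there are $\alpha,\beta\ge N$ with $\alpha$ of type (a) and $\beta$ of type (b), and likewise $\alpha,\beta\le -N$. The $(x_\alpha,y_\alpha)$ with these properties are unique up to replacing $\alpha$ by $\alpha+c$ for a constant integer $c$.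
   Context: An $\mathrm{SL}_2$-tiling is a map $t:\mathbb{Z}\times\mathbb{Z}\to\{1,2,3,\dots\}$, $(i,j)\mapsto t_{ij}$, with $t_{ij}t_{i+1,j+1}-t_{i,j+1}t_{i+1,j}=1$ for all $i,j$. It has enough ones if for every $(i,j)$ there is $(p,q)$ with $p<i$, $q>j$ and $t_{pq}=1$, and there is $(p,q)$ with $p>i$, $q<j$ and $t_{pq}=1$. -}

module Defs where

open import Data.Nat using (ℕ)
open import Data.Integer using (ℤ; +_; _+_; _-_; _*_; _<_; _≤_; _>_; -_; 1ℤ)
open import Data.Product using (_×_; Σ; ∃; ∃-syntax; _,_; proj₁; proj₂)
open import Data.Sum using (_⊎_)
open import Relation.Binary.PropositionalEquality using (_≡_)
open import Function.Bundles using (_⇔_)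

record IsSL2Tiling (t : ℤ → ℤ → ℕ) : Set where
  field
    positive : ∀ i j → 1 Data.Nat.≤ t i j
    det : ∀ i j →
      (+ t i j) * (+ t (i + 1ℤ) (j + 1ℤ)) - (+ t i (j + 1ℤ)) * (+ t (i + 1ℤ) j) ≡ 1ℤ

EnoughOnes : (ℤ → ℤ → ℕ) → Set
EnoughOnes t = ∀ i j →
  (∃[ p ] ∃[ q ] (p < i × j < q × t p q ≡ 1)) ×
  (∃[ p ] ∃[ q ] (i < p × q < j × t p q ≡ 1))

TypeA : (ℤ → ℤ × ℤ) → ℤ → Set
TypeA s α = (proj₁ (s (α + 1ℤ)) < proj₁ (s α)) × (proj₂ (s (α + 1ℤ)) ≡ proj₂ (s α))

TypeB : (ℤ → ℤ × ℤ) → ℤ → Set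
TypeB s α = (proj₁ (s (α + 1ℤ)) ≡ proj₁ (s α)) × (proj₂ (s (α + 1ℤ)) > proj₂ (s α))

IsOnesSequence : (ℤ → ℤ → ℕ) → (ℤ → ℤ × ℤ) → Set
IsOnesSequence t s =
  (∀ x y → (t x y ≡ 1) ⇔ (∃[ α ] (s α ≡ (x , y)))) ×
  (∀ α → TypeA s α ⊎ TypeB s α) ×
  (∀ N → (∃[ α ] (N ≤ α × TypeA s α)) × (∃[ β ] (N ≤ β × TypeB s β))) ×
  (∀ N → (∃[ α ] (α ≤ - N × TypeA s α)) × (∃[ β ] (β ≤ - N × TypeB s β)))

module Submission where

-- Row indices x grow southwards and column indices y eastwards, so (a) moves north and
-- (b) moves east.  Index positions by their diagonal diag (x , y) = y - x.  The proof has
-- three layers.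
-- 1. Positive minors: chaining the unit minors shows that every 2×2 minor of t is
--    positive, so no one lies strictly south-east of another; consequently the ones are
--    totally ordered by diag, a larger diagonal meaning weakly north-east.
-- 2. Local model: north-east of a one, t is given by an explicit bilinear formula whose
--    row and column data are unimodular sequences starting at (1 , 0).  A discrete
--    intermediate value theorem then shows that a one strictly north-east of a one P
--    forces a one on the row of P to its right or on its column above it.  The nearest
--    such one is the successor of P in diagonal order and is reached by a single step;
--    predecessors follow by rotating the plane by 180°.
-- 3. Iterating successor and predecessor from one chosen one gives the path; it visits
--    every one by the diagonal order, and enough ones give the switches (iii).  Any two
--    such paths list the ones in increasing diagonal order, so they differ by a shift.

open import Defs
open import Data.Nat as ℕ using (ℕ; zero; suc; z≤n; s≤s; z<s; s<s⁻¹)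
import Data.Nat.Properties as ℕₚ
open import Data.Integer
  using (ℤ; +_; -[1+_]; +[1+_]; _+_; _-_; _*_; -_; _<_; _≤_; -1ℤ; 0ℤ; 1ℤ; +<+; +≤+; ≢-nonZero)
open import Data.Integer.Properties
open import Data.Integer.Tactic.RingSolver using (solve-∀)
open import Data.Nat.GeneralisedArithmetic using (fold; fold-+)
open import Data.Product using (_×_; Σ; ∃-syntax; _,_; proj₁; proj₂; map₂)
open import Data.Sum using (_⊎_; inj₁; inj₂)
open import Data.Empty using (⊥; ⊥-elim)
open import Relation.Nullary using (¬_; yes; no; Dec)
open import Relation.Binary.Definitions using (tri<; tri≈; tri>)
open import Relation.Binary.PropositionalEquality
open import Function.Bundles using (Equivalence; mk⇔)

minus-plus : ∀ i j → i - j + j ≡ i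
minus-plus = solve-∀

plus-minus : ∀ i j → i + j - j ≡ i
plus-minus = solve-∀

minus-minus : ∀ i j → i - (i - j) ≡ j
minus-minus = solve-∀

+-suc-offset : ∀ i n → i + + n + 1ℤ ≡ i + + suc n
+-suc-offset i n = solve′ i (+ n)
  where
  solve′ : ∀ i k → i + k + 1ℤ ≡ i + (1ℤ + k)
  solve′ = solve-∀

-suc-offset : ∀ i n → i - + suc n + 1ℤ ≡ i - + n
-suc-offset i n = solve′ i (+ n)
  where
  solve′ : ∀ i k → i - (1ℤ + k) + 1ℤ ≡ i - k
  solve′ = solve-∀

≤⇒offset : ∀ {a b} → a ≤ b → ∃[ k ] (b ≡ a + + k)
≤⇒offset {a} {b} a≤b =
  ∣b-a∣ , sym (trans (cong (λ w → a + w) (0≤i⇒+∣i∣≡i (i≤j⇒0≤j-i a≤b))) (a+[b-a] a b))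
  where
  ∣b-a∣ = Data.Integer.∣ b - a ∣
  a+[b-a] : ∀ a b → a + (b - a) ≡ b
  a+[b-a] = solve-∀

<⇒offset : ∀ {a b} → a < b → ∃[ k ] (b ≡ a + + suc k)
<⇒offset {a} a<b with ≤⇒offset (i<j⇒suc[i]≤j a<b)
... | k , b≡ = k , trans b≡ (shift a (+ k))
  where
  shift : ∀ a k → (1ℤ + a) + k ≡ a + (1ℤ + k)
  shift = solve-∀

i≤i+n : ∀ i n → i ≤ i + + n
i≤i+n i n = i≤i+j i (+ n)

i<i+1+n : ∀ i n → i < i + + suc n
i<i+1+n i n = subst (_< i + + suc n) (+-identityʳ i) (+-monoʳ-< i (+<+ z<s))

i+n<i+1+n : ∀ i n → i + + n < i + + suc n
i+n<i+1+n i n = subst (i + + n <_) (+-suc-offset i n) (i<i+1+n (i + + n) 0)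

i-1+n<i : ∀ i n → i - + suc n < i
i-1+n<i i n = subst (i - + suc n <_) (minus-plus i (+ suc n)) (i<i+1+n (i - + suc n) n)

sub-cancelʳ-< : ∀ {u v c} → u - c < v - c → u < v
sub-cancelʳ-< {u} {v} {c} h = subst₂ _<_ (minus-plus u c) (minus-plus v c) (+-monoˡ-< c h)

sub-cancelˡ-< : ∀ {u v c} → c - u < c - v → v < u
sub-cancelˡ-< {u} {v} {c} h =
  neg-cancel-< (subst₂ _<_ (cancel c (- u)) (cancel c (- v)) (+-monoʳ-< (- c) h))
  where
  cancel : ∀ c w → - c + (c + w) ≡ w
  cancel = solve-∀

offset-cancel-< : ∀ c {k m} → c + + k < c + + m → k ℕ.< m
offset-cancel-< c {k} {m} h =
  drop‿+<+ (subst₂ _<_ (cancel c (+ k)) (cancel c (+ m)) (+-monoˡ-< (- c) h))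
  where
  cancel : ∀ c w → c + w - c ≡ w
  cancel = solve-∀

between-offsets : ∀ {c b m} → c < b → b < c + + suc m → ∃[ k ] (k ℕ.< m × b ≡ c + + suc k)
between-offsets {c} c<b b<c+m with <⇒offset c<b
... | k , refl = k , s<s⁻¹ (offset-cancel-< c b<c+m) , refl

between-offsets⁻ : ∀ {c a m} → c - + suc m < a → a < c → ∃[ k ] (k ℕ.< m × a ≡ c - + suc k)
between-offsets⁻ {a = a} {m} c-m<a a<c with <⇒offset a<c
... | k , refl = k , s<s⁻¹ (drop‿+<+ (sub-cancelˡ-< {+ suc m} {+ suc k} {c} c-m<c-k)) , a≡
  where
  c = a + + suc k
  a≡ : a ≡ c - + suc k
  a≡ = sym (plus-minus a (+ suc k))
  c-m<c-k : c - + suc m < c - + suc k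
  c-m<c-k = subst (c - + suc m <_) a≡ c-m<a

1≤diff : ∀ {a b} → a < b → 1ℤ ≤ b - a
1≤diff {a} {b} a<b = subst (_≤ b - a) (cancel a) (+-monoˡ-≤ (- a) (i<j⇒suc[i]≤j a<b))
  where
  cancel : ∀ a → 1ℤ + a - a ≡ 1ℤ
  cancel = solve-∀

1≤*  : ∀ {a b} → 1ℤ ≤ a → 1ℤ ≤ b → 1ℤ ≤ a * b
1≤* {+[1+ m ]} {+[1+ n ]} (+≤+ _) (+≤+ _) = +≤+ (s≤s z≤n)

0<* : ∀ {a b} → 0ℤ < a → 0ℤ < b → 0ℤ < a * b
0<* {+[1+ m ]} {+[1+ n ]} (+<+ _) (+<+ _) = +<+ z<s

0≤+k* : ∀ k {i} → 0ℤ ≤ i → 0ℤ ≤ + k * i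
0≤+k* k {+ n} (+≤+ _) = subst (0ℤ ≤_) (pos-* k n) (+≤+ z≤n)

i≤i*j : ∀ {i j} → 0ℤ ≤ i → 1ℤ ≤ j → i ≤ i * j
i≤i*j {+ m} {+[1+ n ]} (+≤+ _) (+≤+ _) = subst (+ m ≤_) (pos-* m (suc n)) (+≤+ (ℕₚ.m≤m*n m (suc n)))

nonPos*pos : ∀ {f c} → f ≤ 0ℤ → 0ℤ < c → f * c ≤ 0ℤ
nonPos*pos {f} {+[1+ n ]} f≤0 (+<+ _) = *-monoʳ-≤-nonNeg +[1+ n ] f≤0

det₂ : ℤ → ℤ → ℤ → ℤ → ℤ
det₂ a b c d = a * d - b * c

det₂-transpose : ∀ a b c d → det₂ a b c d ≡ det₂ a c b d
det₂-transpose a b c d = cong (λ w → a * d - w) (*-comm b c)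

det₂-rotate : ∀ a b c d → det₂ a b c d ≡ det₂ d c b a
det₂-rotate a b c d = cong₂ _-_ (*-comm a d) (*-comm b c)

-- An integer array is a frieze when all its adjacent 2×2 minors equal 1; an SL₂-tiling
-- is exactly a positive frieze (IsSL2Tiling.det has this type).
Frieze : (ℤ → ℤ → ℤ) → Set
Frieze T = ∀ i j → det₂ (T i j) (T i (j + 1ℤ)) (T (i + 1ℤ) j) (T (i + 1ℤ) (j + 1ℤ)) ≡ 1ℤ

-- The inductive step is the
-- three-term (Plücker) relation  c·|a b;e f′| = a·|c d;e f′| + e·|a b;c d|.
minors-positive : (f g : ℤ → ℕ) → (∀ n → 1 ℕ.≤ f n) →
  (∀ n → 0ℤ < det₂ (+ f n) (+ g n) (+ f (n + 1ℤ)) (+ g (n + 1ℤ))) →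
  ∀ {n m} → n < m → 0ℤ < det₂ (+ f n) (+ g n) (+ f m) (+ g m)
minors-positive f g f-pos adjacent {n} n<m with <⇒offset n<m
... | d , refl = chain d
  where
  Minor : ℤ → ℤ
  Minor m = det₂ (+ f n) (+ g n) (+ f m) (+ g m)
  three-term : ∀ a b c d e f′ →
    c * (a * f′ - b * e) ≡ a * (c * f′ - d * e) + e * (a * d - b * c)
  three-term = solve-∀
  chain : ∀ d → 0ℤ < Minor (n + + suc d)
  chain zero = adjacent n
  chain (suc d) = subst (λ m → 0ℤ < Minor m) (+-suc-offset n (suc d))
                        (*-cancelˡ-<-nonNeg (+ f m) c*minor>0)
    where
    m = n + + suc d
    m′ = m + 1ℤ
    c*minor>0 : + f m * 0ℤ < + f m * Minor m′
    c*minor>0 = subst₂ _<_ (sym (*-zeroʳ (+ f m)))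
      (sym (three-term (+ f n) (+ g n) (+ f m) (+ g m) (+ f m′) (+ g m′)))
      (+-mono-<-≤ (0<* (+<+ (f-pos n)) (adjacent m)) (0≤+k* (f m′) (<⇒≤ (chain d))))

module Minors {t : ℤ → ℤ → ℕ} (tiling : IsSL2Tiling t) where
  open IsSL2Tiling tiling

  adjacent-rows-minor : ∀ i {j l} → j < l →
    0ℤ < det₂ (+ t i j) (+ t i l) (+ t (i + 1ℤ) j) (+ t (i + 1ℤ) l)
  adjacent-rows-minor i {j} {l} j<l =
    subst (0ℤ <_) (det₂-transpose (+ t i j) (+ t (i + 1ℤ) j) (+ t i l) (+ t (i + 1ℤ) l))
      (minors-positive (t i) (t (i + 1ℤ)) (positive i) unit-minor j<l)
    where
    unit-minor : ∀ n → 0ℤ < det₂ (+ t i n) (+ t (i + 1ℤ) n) (+ t i (n + 1ℤ)) (+ t (i + 1ℤ) (n + 1ℤ))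
    unit-minor n = subst (0ℤ <_)
      (sym (trans (det₂-transpose (+ t i n) (+ t (i + 1ℤ) n) (+ t i (n + 1ℤ)) (+ t (i + 1ℤ) (n + 1ℤ)))
                  (det i n)))
      (+<+ z<s)

  minor-positive : ∀ {i j k l} → i < k → j < l → 0ℤ < det₂ (+ t i j) (+ t i l) (+ t k j) (+ t k l)
  minor-positive {j = j} {l = l} i<k j<l =
    minors-positive (λ r → t r j) (λ r → t r l) (λ r → positive r j)
                    (λ r → adjacent-rows-minor r j<l) i<k

  -- Hence no one lies strictly south-east of another one, for their minor would be
  -- 1 - t_il t_kj ≤ 0.
  ones-antichain : ∀ {i j k l} → i < k → j < l → t i j ≡ 1 → t k l ≡ 1 → ⊥
  ones-antichain {i} {j} {k} {l} i<k j<l one₁ one₂ = ≤⇒≯ minor≤0 (minor-positive i<k j<l)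
    where
    1≤product : 1ℤ ≤ + t i l * + t k j
    1≤product = 1≤* (+≤+ (positive i l)) (+≤+ (positive k j))
    minor≤0 : det₂ (+ t i j) (+ t i l) (+ t k j) (+ t k l) ≤ 0ℤ
    minor≤0 rewrite one₁ | one₂ = i≤j⇒i-j≤0 1≤product

-- If p > q > 0 and s > r > 0 then  p s - q r = q (s - r) + (p - q) s ≥ 2.
det-exceeds-one : ∀ {p q r s} → 0ℤ < q → 0ℤ < r → q < p → r < s → 1ℤ < det₂ p q r s
det-exceeds-one {p} {q} {r} {s} 0<q 0<r q<p r<s =
  subst (1ℤ <_) (sym (split p q r s)) (<-≤-trans (+<+ ℕₚ.≤-refl) (+-mono-≤ first second))
  where
  split : ∀ p q r s → p * s - q * r ≡ q * (s - r) + (p - q) * s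
  split = solve-∀
  first : 1ℤ ≤ q * (s - r)
  first = 1≤* (i<j⇒suc[i]≤j 0<q) (1≤diff r<s)
  second : 1ℤ ≤ (p - q) * s
  second = 1≤* (1≤diff q<p) (i<j⇒suc[i]≤j (<-trans 0<r r<s))

-- One crossing step: if (a , b), (a′ , b′) have determinant 1, a , a′ > 0, b < a and
-- a′ ≤ b′, then a′ = 1, since  a′ (a - b) = 1 + (a′ - b′) a ≤ 1.
crossing-step : ∀ {a b a′ b′} → 0ℤ < a → 0ℤ < a′ → b < a → a′ ≤ b′ →
  det₂ a b a′ b′ ≡ 1ℤ → a′ ≡ 1ℤ
crossing-step {a} {b} {a′} {b′} 0<a 0<a′ b<a a′≤b′ unimodular =
  ≤-antisym (≤-trans (i≤i*j (<⇒≤ 0<a′) (1≤diff b<a)) product≤1) (i<j⇒suc[i]≤j 0<a′)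
  where
  expand : ∀ a b a′ b′ → a′ * (a - b) ≡ a * b′ - b * a′ + (a′ - b′) * a
  expand = solve-∀
  product≤1 : a′ * (a - b) ≤ 1ℤ
  product≤1 = subst (_≤ 1ℤ) (sym (trans (expand a b a′ b′) (cong (_+ (a′ - b′) * a) unimodular)))
    (+-monoʳ-≤ 1ℤ (nonPos*pos (i≤j⇒i-j≤0 a′≤b′) 0<a))

-- A discrete intermediate value theorem: for a sequence of integer pairs (a n , b n)
-- with consecutive determinants 1, a positive and b 0 < a 0, if b catches up with a at
-- some N then a takes the value 1 at a positive index (at the first crossing).
unimodular-crossing : (a b : ℕ → ℤ) → (∀ n → 0ℤ < a n) → b 0 < a 0 →
  (∀ n → det₂ (a n) (b n) (a (suc n)) (b (suc n)) ≡ 1ℤ) →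
  ∀ N → a N ≤ b N → ∃[ n ] (a (suc n) ≡ 1ℤ)
unimodular-crossing a b a-pos b₀<a₀ unimodular zero a≤b = ⊥-elim (≤⇒≯ a≤b b₀<a₀)
unimodular-crossing a b a-pos b₀<a₀ unimodular (suc N) a≤b with a N ≤? b N
... | yes a≤b-earlier = unimodular-crossing a b a-pos b₀<a₀ unimodular N a≤b-earlier
... | no  b≮a = N , crossing-step (a-pos N) (a-pos (suc N)) (≰⇒> b≮a) a≤b (unimodular N)

frieze-fill : ∀ {a b b′ c d} → c ≢ 0ℤ → det₂ a b c d ≡ 1ℤ → det₂ a b′ c d ≡ 1ℤ → b ≡ b′
frieze-fill {a} {b} {b′} {c} {d} c≢0 unit unit′ =
  *-cancelʳ-≡ b b′ c {{≢-nonZero c≢0}}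
    (trans (sym (minus-minus (a * d) (b * c)))
      (trans (cong (λ w → a * d - w) (trans unit (sym unit′))) (minus-minus (a * d) (b′ * c))))

-- Two friezes T, F with T nowhere zero that agree on row x and on column y agree on the
-- whole quadrant {i ≤ x, j ≥ y}: fill it minor by minor, moving up and to the right.
frieze-extension : ∀ {T F : ℤ → ℤ → ℤ} → Frieze T → Frieze F → (∀ i j → T i j ≢ 0ℤ) →
  ∀ {x y} → (∀ j → T x j ≡ F x j) → (∀ i → T i y ≡ F i y) →
  ∀ {i j} → i ≤ x → y ≤ j → T i j ≡ F i j
frieze-extension {T} {F} T-frieze F-frieze T≢0 {x} {y} row col {i} i≤x y≤j
  with ≤⇒offset i≤x | ≤⇒offset y≤j
... | m , refl | n , refl = subst (λ i′ → Agree i′ (y + + n)) (plus-minus i (+ m)) (fill m n)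
  where
  Agree : ℤ → ℤ → Set
  Agree i j = T i j ≡ F i j
  fill : ∀ m n → Agree (x - + m) (y + + n)
  fill zero n = subst (λ i′ → Agree i′ (y + + n)) (sym (+-identityʳ x)) (row (y + + n))
  fill (suc m) zero = subst (Agree (x - + suc m)) (sym (+-identityʳ y)) (col (x - + suc m))
  fill (suc m) (suc n) = subst (Agree i′) (+-suc-offset y n)
      (frieze-fill {T i′ j′} {d = T (i′ + 1ℤ) (j′ + 1ℤ)} (T≢0 (i′ + 1ℤ) j′) (T-frieze i′ j′) F-minor)
    where
    i′ = x - + suc m
    j′ = y + + n
    below : Agree (i′ + 1ℤ) j′
    below = subst (λ r → Agree r j′) (sym (-suc-offset x m)) (fill m n)
    diagonal : Agree (i′ + 1ℤ) (j′ + 1ℤ)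
    diagonal = subst₂ Agree (sym (-suc-offset x m)) (sym (+-suc-offset y n)) (fill m (suc n))
    F-minor : det₂ (T i′ j′) (F i′ (j′ + 1ℤ)) (T (i′ + 1ℤ) j′) (T (i′ + 1ℤ) (j′ + 1ℤ)) ≡ 1ℤ
    F-minor rewrite fill (suc m) n | below | diagonal = F-frieze i′ j′

-- The local model at a one t x y = 1.  On the quadrant north-east of (x , y) the tiling
-- is  t i j = p i · s j - q i · r j,  where (p , q) is read off the columns y, y + 1 and
-- (s , r) off the rows x, x - 1.  Walking along row x (resp. column y) the pairs (s , r)
-- (resp. (p , q)) are unimodular and start at (1 , 0); this locates ones on the row or
-- column of (x , y).
module LocalModel {t : ℤ → ℤ → ℕ} (tiling : IsSL2Tiling t) {x y : ℤ} (one : t x y ≡ 1) where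
  open IsSL2Tiling tiling
  open Minors tiling

  k l : ℤ
  k = + t (x - 1ℤ) y
  l = + t x (y + 1ℤ)

  p q s r : ℤ → ℤ
  p i = + t i y
  q i = p i * l - + t i (y + 1ℤ)
  s j = + t x j
  r j = k * s j - + t (x - 1ℤ) j

  model : ℤ → ℤ → ℤ
  model i j = det₂ (p i) (q i) (r j) (s j)

  column-unimodular : ∀ i → det₂ (p (i + 1ℤ)) (q (i + 1ℤ)) (p i) (q i) ≡ 1ℤ
  column-unimodular i =
    trans (expand (p i) (+ t i (y + 1ℤ)) (p (i + 1ℤ)) (+ t (i + 1ℤ) (y + 1ℤ)) l) (det i y)
    where
    expand : ∀ P Q P′ Q′ l → P′ * (P * l - Q) - (P′ * l - Q′) * P ≡ P * Q′ - Q * P′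
    expand = solve-∀

  row-unimodular : ∀ j → det₂ (s j) (r j) (s (j + 1ℤ)) (r (j + 1ℤ)) ≡ 1ℤ
  row-unimodular j = trans (expand (s j) (s (j + 1ℤ)) (+ t (x - 1ℤ) j) (+ t (x - 1ℤ) (j + 1ℤ)) k)
    (subst (λ i → + t (x - 1ℤ) j * + t i (j + 1ℤ) - + t (x - 1ℤ) (j + 1ℤ) * + t i j ≡ 1ℤ)
           (minus-plus x 1ℤ) (det (x - 1ℤ) j))
    where
    expand : ∀ X X′ Y Y′ k → X * (k * X′ - Y′) - (k * X - Y) * X′ ≡ Y * X′ - Y′ * X
    expand = solve-∀

  -- Hence the model is itself a frieze: its minors factor as products of the above.
  model-frieze : Frieze model
  model-frieze i j = trans
    (factor (p i) (q i) (p (i + 1ℤ)) (q (i + 1ℤ)) (s j) (r j) (s (j + 1ℤ)) (r (j + 1ℤ)))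
    (cong₂ _*_ (column-unimodular i) (row-unimodular j))
    where
    factor : ∀ p q p′ q′ s r s′ r′ →
      (p * s - q * r) * (p′ * s′ - q′ * r′) - (p * s′ - q * r′) * (p′ * s - q′ * r)
        ≡ (p′ * q - q′ * p) * (s * r′ - r * s′)
    factor = solve-∀

  row-agrees : ∀ j → + t x j ≡ model x j
  row-agrees j rewrite one = sym (simplify l (s j) (r j))
    where
    simplify : ∀ l s r → 1ℤ * s - (1ℤ * l - l) * r ≡ s
    simplify = solve-∀

  column-agrees : ∀ i → + t i y ≡ model i y
  column-agrees i rewrite one = sym (simplify (p i) (q i) k)
    where
    simplify : ∀ p q k → p * 1ℤ - q * (k * 1ℤ - k) ≡ p
    simplify = solve-∀

  model-agrees : ∀ {i j} → i ≤ x → y ≤ j → + t i j ≡ model i j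
  model-agrees = frieze-extension {T = λ i j → + t i j} {F = model}
                   det model-frieze nonzero row-agrees column-agrees
    where
    nonzero : ∀ i j → + t i j ≢ 0ℤ
    nonzero i j t≡0 = ℕₚ.<⇒≢ (positive i j) (sym (+-injective t≡0))

  q-positive : ∀ {i} → i < x → 0ℤ < q i
  q-positive {i} i<x = subst (0ℤ <_) minor≡q (minor-positive i<x (i<i+1+n y 0))
    where
    minor≡q : det₂ (+ t i y) (+ t i (y + 1ℤ)) (+ t x y) (+ t x (y + 1ℤ)) ≡ q i
    minor≡q rewrite one = cong (λ w → p i * l - w) (*-identityʳ (+ t i (y + 1ℤ)))

  r-positive : ∀ {j} → y < j → 0ℤ < r j
  r-positive {j} y<j = subst (0ℤ <_) minor≡r (minor-positive (i-1+n<i x 0) y<j)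
    where
    minor≡r : det₂ (+ t (x - 1ℤ) y) (+ t (x - 1ℤ) j) (+ t x y) (+ t x j) ≡ r j
    minor≡r rewrite one = cong (λ w → k * s j - w) (*-identityʳ (+ t (x - 1ℤ) j))

  p-corner : p x ≡ 1ℤ
  p-corner = cong +_ one

  q-corner : q x ≡ 0ℤ
  q-corner rewrite one = simplify l
    where
    simplify : ∀ l → 1ℤ * l - l ≡ 0ℤ
    simplify = solve-∀

  s-corner : s y ≡ 1ℤ
  s-corner = cong +_ one

  r-corner : r y ≡ 0ℤ
  r-corner rewrite one = simplify k
    where
    simplify : ∀ k → k * 1ℤ - k ≡ 0ℤ
    simplify = solve-∀

  row-crossing : ∀ {j} → y ≤ j → s j ≤ r j → ∃[ d ] (t x (y + + suc d) ≡ 1)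
  row-crossing y≤j s≤r with ≤⇒offset y≤j
  ... | N , refl = map₂ +-injective
        (unimodular-crossing a b (λ n → +<+ (positive x (y + + n))) b₀<a₀ unimodular N s≤r)
    where
    a b : ℕ → ℤ
    a n = s (y + + n)
    b n = r (y + + n)
    b₀<a₀ : b 0 < a 0
    b₀<a₀ = subst₂ _<_ (sym (trans (cong r (+-identityʳ y)) r-corner))
                       (sym (trans (cong s (+-identityʳ y)) s-corner)) (+<+ z<s)
    unimodular : ∀ n → det₂ (a n) (b n) (a (suc n)) (b (suc n)) ≡ 1ℤ
    unimodular n = subst (λ j → det₂ (a n) (b n) (s j) (r j) ≡ 1ℤ) (+-suc-offset y n)
                         (row-unimodular (y + + n))

  column-crossing : ∀ {i} → i ≤ x → p i ≤ q i → ∃[ d ] (t (x - + suc d) y ≡ 1)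
  column-crossing {i} i≤x p≤q with ≤⇒offset i≤x
  ... | M , x≡ = map₂ +-injective
        (unimodular-crossing a b (λ n → +<+ (positive (x - + n) y)) b₀<a₀ unimodular M a≤b)
    where
    a b : ℕ → ℤ
    a n = p (x - + n)
    b n = q (x - + n)
    b₀<a₀ : b 0 < a 0
    b₀<a₀ = subst₂ _<_ (sym (trans (cong q (+-identityʳ x)) q-corner))
                       (sym (trans (cong p (+-identityʳ x)) p-corner)) (+<+ z<s)
    unimodular : ∀ n → det₂ (a n) (b n) (a (suc n)) (b (suc n)) ≡ 1ℤ
    unimodular n = subst (λ i → det₂ (p i) (q i) (a (suc n)) (b (suc n)) ≡ 1ℤ) (-suc-offset x n)
                         (column-unimodular (x - + suc n))
    a≤b : a M ≤ b M
    a≤b = subst (λ i → p i ≤ q i) (trans (sym (plus-minus i (+ M))) (cong (_- + M) (sym x≡))) p≤q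

  -- A one strictly north-east of (x , y) forces a one on row x to the right of y or on
  -- column y above x: otherwise p > q > 0 and s > r > 0 there, so the model exceeds 1.
  one-on-arm : ∀ {x′ y′} → x′ < x → y < y′ → t x′ y′ ≡ 1 →
    (∃[ d ] (t x (y + + suc d) ≡ 1)) ⊎ (∃[ d ] (t (x - + suc d) y ≡ 1))
  one-on-arm {x′} {y′} x′<x y<y′ one′ with s y′ ≤? r y′ | p x′ ≤? q x′
  ... | yes s≤r | _       = inj₁ (row-crossing (<⇒≤ y<y′) s≤r)
  ... | no  s≰r | yes p≤q = inj₂ (column-crossing (<⇒≤ x′<x) p≤q)
  ... | no  s≰r | no  p≰q = ⊥-elim (<-irrefl (sym model≡1)
        (det-exceeds-one (q-positive x′<x) (r-positive y<y′) (≰⇒> p≰q) (≰⇒> s≰r)))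
    where
    model≡1 : model x′ y′ ≡ 1ℤ
    model≡1 = trans (sym (model-agrees (<⇒≤ x′<x) (<⇒≤ y<y′))) (cong +_ one′)

Pos : Set
Pos = ℤ × ℤ

diag : Pos → ℤ
diag P = proj₂ P - proj₁ P

IsOne : (ℤ → ℤ → ℕ) → Pos → Set
IsOne t P = t (proj₁ P) (proj₂ P) ≡ 1

diag-right : ∀ {x y x′ y′} → x < x′ → y - x ≤ y′ - x′ → y < y′
diag-right {x} {y} {x′} {y′} x<x′ d≤d′ =
  subst₂ _<_ (minus-plus y x) (minus-plus y′ x′) (+-mono-≤-< d≤d′ x<x′)

diag-up : ∀ {x y x′ y′} → y′ < y → y - x ≤ y′ - x′ → x′ < x
diag-up {x} {y} {x′} {y′} y′<y d≤d′ =
  subst₂ _<_ (minus-minus y′ x′) (minus-minus y x) (+-mono-<-≤ y′<y (neg-mono-≤ d≤d′))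

module DiagonalOrder {t : ℤ → ℤ → ℕ} (tiling : IsSL2Tiling t) where
  open Minors tiling

  ones-ordered : ∀ {P Q} → IsOne t P → IsOne t Q → diag P < diag Q →
    proj₁ Q ≤ proj₁ P × proj₂ P ≤ proj₂ Q
  ones-ordered {xP , yP} {xQ , yQ} oneP oneQ P<Q = ≮⇒≥ not-below , ≮⇒≥ not-left
    where
    not-below : ¬ (xP < xQ)
    not-below xP<xQ = ones-antichain xP<xQ (diag-right xP<xQ (<⇒≤ P<Q)) oneP oneQ
    not-left : ¬ (yQ < yP)
    not-left yQ<yP = ones-antichain (diag-up yQ<yP (<⇒≤ P<Q)) yQ<yP oneQ oneP

  diag-injective : ∀ {P Q} → IsOne t P → IsOne t Q → diag P ≡ diag Q → P ≡ Q
  diag-injective {xP , yP} {xQ , yQ} oneP oneQ same with <-cmp xP xQ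
  ... | tri< xP<xQ _ _ =
    ⊥-elim (ones-antichain xP<xQ (diag-right xP<xQ (≤-reflexive same)) oneP oneQ)
  ... | tri> _ _ xQ<xP =
    ⊥-elim (ones-antichain xQ<xP (diag-right xQ<xP (≤-reflexive (sym same))) oneQ oneP)
  ... | tri≈ _ refl _  = cong (xP ,_)
        (trans (sym (minus-plus yP xP)) (trans (cong (_+ xP) same) (minus-plus yQ xP)))

  between-on-row : ∀ {x y y′ a b} → t x y ≡ 1 → t x y′ ≡ 1 → t a b ≡ 1 →
    y - x < b - a → b - a < y′ - x → a ≡ x × y < b × b < y′
  between-on-row {x} {y} {y′} {a} {b} one one′ oneZ P<Z Z<R with
    ≤-antisym (proj₁ (ones-ordered {x , y} {a , b} one oneZ P<Z))
              (proj₁ (ones-ordered {a , b} {x , y′} oneZ one′ Z<R))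
  ... | refl = refl , sub-cancelʳ-< P<Z , sub-cancelʳ-< Z<R

  between-on-column : ∀ {x x′ y a b} → t x y ≡ 1 → t x′ y ≡ 1 → t a b ≡ 1 →
    y - x < b - a → b - a < y - x′ → b ≡ y × x′ < a × a < x
  between-on-column {x} {x′} {y} {a} {b} one one′ oneZ P<Z Z<R with
    ≤-antisym (proj₂ (ones-ordered {a , b} {x′ , y} oneZ one′ Z<R))
              (proj₂ (ones-ordered {x , y} {a , b} one oneZ P<Z))
  ... | refl = refl , sub-cancelˡ-< {c = y} Z<R , sub-cancelˡ-< {c = y} P<Z

least-witness : ∀ (P : ℕ → Set) → (∀ n → Dec (P n)) → ∀ {n} → P n →
  ∃[ m ] (P m × (∀ k → k ℕ.< m → ¬ P k))
least-witness P P? {zero} p₀ = 0 , p₀ , λ _ ()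
least-witness P P? {suc n} pₙ with P? 0
... | yes p₀ = 0 , p₀ , λ _ ()
... | no ¬p₀ with least-witness (λ k → P (suc k)) (λ k → P? (suc k)) pₙ
...   | m , pₘ , none-below = suc m , pₘ , earlier
  where
  earlier : ∀ k → k ℕ.< suc m → ¬ P k
  earlier zero    _   = ¬p₀
  earlier (suc k) k<m = none-below k (s<s⁻¹ k<m)

-- Steps of the path of ones: (a) up a column, (b) right along a row.  Step (s α) (s (α + 1))
-- is definitionally TypeA s α ⊎ TypeB s α.
StepA StepB Step : Pos → Pos → Set
StepA P R = (proj₁ R < proj₁ P) × (proj₂ R ≡ proj₂ P)
StepB P R = (proj₁ R ≡ proj₁ P) × (proj₂ P < proj₂ R)
Step P R = StepA P R ⊎ StepB P R

step-increases-diag : ∀ {P R} → Step P R → diag P < diag R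
step-increases-diag {x , y} {x′ , y′} (inj₁ (x′<x , y′≡y)) =
  subst (λ w → y - x < w - x′) (sym y′≡y) (+-monoʳ-< y (neg-mono-< x′<x))
step-increases-diag {x , y} {x′ , y′} (inj₂ (x′≡x , y<y′)) =
  subst (λ w → y - x < y′ - w) (sym x′≡x) (+-monoˡ-< (- x) y<y′)

Successor : (ℤ → ℤ → ℕ) → Pos → Set
Successor t P = ∃[ R ] (IsOne t R × Step P R ×
  (∀ Z → IsOne t Z → diag P < diag Z → diag R ≤ diag Z))

Predecessor : (ℤ → ℤ → ℕ) → Pos → Set
Predecessor t P = ∃[ R ] (IsOne t R × Step R P ×
  (∀ Z → IsOne t Z → diag Z < diag P → diag Z ≤ diag R))

NorthEastOnes SouthWestOnes : (ℤ → ℤ → ℕ) → Set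
NorthEastOnes t = ∀ i j → ∃[ p ] ∃[ q ] (p < i × j < q × t p q ≡ 1)
SouthWestOnes t = ∀ i j → ∃[ p ] ∃[ q ] (i < p × q < j × t p q ≡ 1)

module Successors {t : ℤ → ℤ → ℕ} (tiling : IsSL2Tiling t) (north-east : NorthEastOnes t) where
  open DiagonalOrder tiling

  successor-on-row : ∀ {x y} → t x y ≡ 1 → ∃[ d ] (t x (y + + suc d) ≡ 1) → Successor t (x , y)
  successor-on-row {x} {y} one (d , one-d)
    with least-witness (λ d → t x (y + + suc d) ≡ 1) (λ d → t x (y + + suc d) ℕ.≟ 1) one-d
  ... | m , one-m , none-before = (x , y + + suc m) , one-m , inj₂ (refl , i<i+1+n y m) , nearest
    where
    nearest : ∀ Z → IsOne t Z → diag (x , y) < diag Z → diag (x , y + + suc m) ≤ diag Z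
    nearest (a , b) oneZ P<Z with diag (x , y + + suc m) ≤? diag (a , b)
    ... | yes R≤Z = R≤Z
    ... | no  R≰Z with between-on-row one one-m oneZ P<Z (≰⇒> R≰Z)
    ...   | refl , y<b , b<R with between-offsets y<b b<R
    ...     | k , k<m , refl = ⊥-elim (none-before k k<m oneZ)

  successor-on-column : ∀ {x y} → t x y ≡ 1 → ∃[ d ] (t (x - + suc d) y ≡ 1) → Successor t (x , y)
  successor-on-column {x} {y} one (d , one-d)
    with least-witness (λ d → t (x - + suc d) y ≡ 1) (λ d → t (x - + suc d) y ℕ.≟ 1) one-d
  ... | m , one-m , none-before = (x - + suc m , y) , one-m , inj₁ (i-1+n<i x m , refl) , nearest
    where
    nearest : ∀ Z → IsOne t Z → diag (x , y) < diag Z → diag (x - + suc m , y) ≤ diag Z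
    nearest (a , b) oneZ P<Z with diag (x - + suc m , y) ≤? diag (a , b)
    ... | yes R≤Z = R≤Z
    ... | no  R≰Z with between-on-column one one-m oneZ P<Z (≰⇒> R≰Z)
    ...   | refl , R<a , a<x with between-offsets⁻ R<a a<x
    ...     | k , k<m , refl = ⊥-elim (none-before k k<m oneZ)

  successor : ∀ {P} → IsOne t P → Successor t P
  successor {x , y} one with north-east x y
  ... | x′ , y′ , x′<x , y<y′ , one′ with LocalModel.one-on-arm tiling one x′<x y<y′ one′
  ...   | inj₁ on-row    = successor-on-row one on-row
  ...   | inj₂ on-column = successor-on-column one on-column

-- Rotation of the plane by 180°: it maps SL₂-tilings to SL₂-tilings, ones to ones,
-- reverses steps and negates diagonals.  It turns successors into predecessors.
rotate : (ℤ → ℤ → ℕ) → ℤ → ℤ → ℕ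
rotate t i j = t (- i) (- j)

rotate-pos : Pos → Pos
rotate-pos P = - proj₁ P , - proj₂ P

rotate-tiling : ∀ {t} → IsSL2Tiling t → IsSL2Tiling (rotate t)
rotate-tiling {t} tiling = record { positive = λ i j → positive (- i) (- j) ; det = rotated-frieze }
  where
  open IsSL2Tiling tiling
  neg-succ : ∀ i → - (i + 1ℤ) + 1ℤ ≡ - i
  neg-succ = solve-∀
  rotated-frieze : Frieze (λ i j → + t (- i) (- j))
  rotated-frieze i j =
    trans (det₂-rotate (+ t (- i) (- j)) (+ t (- i) b) (+ t a (- j)) (+ t a b))
          (subst₂ (λ u v → det₂ (+ t a b) (+ t a v) (+ t u b) (+ t u v) ≡ 1ℤ)
                  (neg-succ i) (neg-succ j) (det a b))
    where
    a = - (i + 1ℤ)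
    b = - (j + 1ℤ)

rotate-one : ∀ {t P} → IsOne t P → IsOne (rotate t) (rotate-pos P)
rotate-one {t} {x , y} one =
  subst₂ (λ u v → t u v ≡ 1) (sym (neg-involutive x)) (sym (neg-involutive y)) one

diag-rotate : ∀ P → diag (rotate-pos P) ≡ - diag P
diag-rotate (x , y) = negate x y
  where
  negate : ∀ x y → - y - - x ≡ - (y - x)
  negate = solve-∀

rotate-step : ∀ {P R} → Step (rotate-pos P) R → Step (rotate-pos R) P
rotate-step {x , y} (inj₁ (a<-x , b≡-y)) =
  inj₁ (subst (_< _) (neg-involutive x) (neg-mono-< a<-x) ,
        sym (trans (cong -_ b≡-y) (neg-involutive y)))
rotate-step {x , y} (inj₂ (a≡-x , -y<b)) =
  inj₂ (sym (trans (cong -_ a≡-x) (neg-involutive x)) ,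
        subst (_ <_) (neg-involutive y) (neg-mono-< -y<b))

module Predecessors {t : ℤ → ℤ → ℕ} (tiling : IsSL2Tiling t) (south-west : SouthWestOnes t) where

  rotated-north-east : NorthEastOnes (rotate t)
  rotated-north-east i j with south-west (- i) (- j)
  ... | p , q , -i<p , q<-j , one =
    - p , - q , subst (- p <_) (neg-involutive i) (neg-mono-< -i<p) ,
    subst (_< - q) (neg-involutive j) (neg-mono-< q<-j) , rotate-one {t} {p , q} one

  open Successors (rotate-tiling tiling) rotated-north-east

  predecessor : ∀ {P} → IsOne t P → Predecessor t P
  predecessor {P} one with successor (rotate-one {t} {P} one)
  ... | R , oneR , step , nearest = rotate-pos R , oneR , rotate-step step , furthest
    where
    furthest : ∀ Z → IsOne t Z → diag Z < diag P → diag Z ≤ diag (rotate-pos R)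
    furthest Z oneZ Z<P = subst₂ _≤_ (neg-involutive (diag Z)) (sym (diag-rotate R))
      (neg-mono-≤ (subst (diag R ≤_) (diag-rotate Z)
        (nearest (rotate-pos Z) (rotate-one {t} {Z} oneZ)
          (subst₂ _<_ (sym (diag-rotate P)) (sym (diag-rotate Z)) (neg-mono-< Z<P)))))

module StepSequence (s : ℤ → Pos) (step : ∀ α → TypeA s α ⊎ TypeB s α) where

  diag-increasing : ∀ {α β} → α < β → diag (s α) < diag (s β)
  diag-increasing {α} α<β with <⇒offset α<β
  ... | d , refl = climb d
    where
    climb : ∀ d → diag (s α) < diag (s (α + + suc d))
    climb zero    = step-increases-diag (step α)
    climb (suc d) = <-trans (climb d)
      (subst (λ β → diag (s (α + + suc d)) < diag (s β)) (+-suc-offset α (suc d))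
             (step-increases-diag (step (α + + suc d))))

  diag-monotone : ∀ {α β} → α ≤ β → diag (s α) ≤ diag (s β)
  diag-monotone {α} α≤β with ≤⇒offset α≤β
  ... | zero  , refl = ≤-reflexive (cong (λ β → diag (s β)) (sym (+-identityʳ α)))
  ... | suc d , refl = <⇒≤ (diag-increasing (i<i+1+n α d))

  diag-reflects : ∀ {α β} → diag (s α) < diag (s β) → α < β
  diag-reflects {α} {β} α<β with <-cmp α β
  ... | tri< lt _ _ = lt
  ... | tri≈ _ refl _ = ⊥-elim (<-irrefl refl α<β)
  ... | tri> _ _ gt = ⊥-elim (<-asym α<β (diag-increasing gt))

  index-injective : ∀ {α β} → diag (s α) ≡ diag (s β) → α ≡ β
  index-injective {α} {β} same with <-cmp α β
  ... | tri< lt _ _ = ⊥-elim (<-irrefl same (diag-increasing lt))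
  ... | tri≈ _ eq _ = eq
  ... | tri> _ _ gt = ⊥-elim (<-irrefl (sym same) (diag-increasing gt))

  change-between : (f : ℤ → ℤ) → ∀ {a b} → a ≤ b → f a ≢ f b →
    ∃[ α ] (a ≤ α × α < b × f (α + 1ℤ) ≢ f α)
  change-between f {a} a≤b differ with ≤⇒offset a≤b
  ... | d , refl = search d differ
    where
    search : ∀ d → f a ≢ f (a + + d) → ∃[ α ] (a ≤ α × α < a + + d × f (α + 1ℤ) ≢ f α)
    search zero differ = ⊥-elim (differ (cong f (sym (+-identityʳ a))))
    search (suc d) differ with f (a + + d + 1ℤ) ≟ f (a + + d)
    ... | no changes = a + + d , i≤i+n a d , i+n<i+1+n a d , changes
    ... | yes same with search d (λ e → differ (trans e (trans (sym same) (cong f (+-suc-offset a d)))))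
    ...   | α , a≤α , α<end , changes = α , a≤α , <-trans α<end (i+n<i+1+n a d) , changes

  typeA-between : ∀ {a b} → a ≤ b → proj₁ (s b) < proj₁ (s a) → ∃[ α ] (a ≤ α × α < b × TypeA s α)
  typeA-between a≤b up with change-between (λ α → proj₁ (s α)) a≤b (λ e → <-irrefl (sym e) up)
  ... | α , a≤α , α<b , changes with step α
  ...   | inj₁ typeA = α , a≤α , α<b , typeA
  ...   | inj₂ (same , _) = ⊥-elim (changes same)

  typeB-between : ∀ {a b} → a ≤ b → proj₂ (s a) < proj₂ (s b) → ∃[ α ] (a ≤ α × α < b × TypeB s α)
  typeB-between a≤b right with change-between (λ α → proj₂ (s α)) a≤b (λ e → <-irrefl e right)
  ... | α , a≤α , α<b , changes with step α
  ...   | inj₁ (_ , same) = ⊥-elim (changes same)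
  ...   | inj₂ typeB = α , a≤α , α<b , typeB

module Existence {t : ℤ → ℤ → ℕ} (tiling : IsSL2Tiling t) (enough : EnoughOnes t) where
  open DiagonalOrder tiling
  open Successors tiling (λ i j → proj₁ (enough i j))
  open Predecessors tiling (λ i j → proj₂ (enough i j))

  -- Ones of t; next and prev are kept abstract so that later proofs do not unfold the
  -- successor construction.
  One : Set
  One = Σ Pos (IsOne t)

  abstract
    next prev : One → One
    next (P , one) = proj₁ (successor one) , proj₁ (proj₂ (successor one))
    prev (P , one) = proj₁ (predecessor one) , proj₁ (proj₂ (predecessor one))

    next-step : ∀ O → Step (proj₁ O) (proj₁ (next O))
    next-step (P , one) = proj₁ (proj₂ (proj₂ (successor one)))

    prev-step : ∀ O → Step (proj₁ (prev O)) (proj₁ O)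
    prev-step (P , one) = proj₁ (proj₂ (proj₂ (predecessor one)))

    next-nearest : ∀ O Z → IsOne t Z → diag (proj₁ O) < diag Z → diag (proj₁ (next O)) ≤ diag Z
    next-nearest (P , one) = proj₂ (proj₂ (proj₂ (successor one)))

    prev-nearest : ∀ O Z → IsOne t Z → diag Z < diag (proj₁ O) → diag Z ≤ diag (proj₁ (prev O))
    prev-nearest (P , one) = proj₂ (proj₂ (proj₂ (predecessor one)))

  start : One
  start with proj₁ (enough 0ℤ 0ℤ)
  ... | p , q , _ , _ , one = (p , q) , one

  path : ℤ → One
  path (+ n)    = fold start next n
  path -[1+ n ] = fold (prev start) prev n

  sequence : ℤ → Pos
  sequence α = proj₁ (path α)

  sequence-step : ∀ α → TypeA sequence α ⊎ TypeB sequence α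
  sequence-step (+ n) = subst (λ β → Step (sequence (+ n)) (sequence β)) (cong +_ (ℕₚ.+-comm 1 n))
                              (next-step (path (+ n)))
  sequence-step -[1+ zero ]  = prev-step start
  sequence-step -[1+ suc n ] = prev-step (path -[1+ n ])

  -- Iterating next from O reaches every one Z of diagonal at least that of O: each
  -- iteration moves to the nearest larger diagonal and so cannot jump over Z.  The fuel n
  -- bounds the diagonal gap.
  reach-forward : ∀ n O Z → IsOne t Z → diag (proj₁ O) ≤ diag Z → diag Z ≤ diag (proj₁ O) + + n →
    ∃[ k ] (proj₁ (fold O next k) ≡ Z)
  reach-forward zero O Z oneZ O≤Z Z≤O =
    0 , diag-injective (proj₂ O) oneZ (≤-antisym O≤Z (subst (diag Z ≤_) (+-identityʳ _) Z≤O))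
  reach-forward (suc n) O Z oneZ O≤Z Z≤O+n with diag (proj₁ O) ≟ diag Z
  ... | yes same = 0 , diag-injective (proj₂ O) oneZ same
  ... | no differ
    with reach-forward n (next O) Z oneZ (next-nearest O Z oneZ (≤∧≢⇒< O≤Z differ)) Z≤next+n
    where
    shift : ∀ a m → (1ℤ + a) + m ≡ a + (1ℤ + m)
    shift = solve-∀
    Z≤next+n : diag Z ≤ diag (proj₁ (next O)) + + n
    Z≤next+n = ≤-trans Z≤O+n (subst (_≤ diag (proj₁ (next O)) + + n) (shift (diag (proj₁ O)) (+ n))
                 (+-monoˡ-≤ (+ n) (i<j⇒suc[i]≤j (step-increases-diag (next-step O)))))
  ...   | k , reached = k ℕ.+ 1 , trans (cong proj₁ (fold-+ O next k)) reached

  reach-backward : ∀ n O Z → IsOne t Z → diag Z ≤ diag (proj₁ O) → diag (proj₁ O) ≤ diag Z + + n →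
    ∃[ k ] (proj₁ (fold O prev k) ≡ Z)
  reach-backward zero O Z oneZ Z≤O O≤Z =
    0 , diag-injective (proj₂ O) oneZ (≤-antisym (subst (diag (proj₁ O) ≤_) (+-identityʳ _) O≤Z) Z≤O)
  reach-backward (suc n) O Z oneZ Z≤O O≤Z+n with diag Z ≟ diag (proj₁ O)
  ... | yes same = 0 , diag-injective (proj₂ O) oneZ (sym same)
  ... | no differ
    with reach-backward n (prev O) Z oneZ (prev-nearest O Z oneZ (≤∧≢⇒< Z≤O differ)) prev≤Z+n
    where
    shift : ∀ a m → -1ℤ + (a + (1ℤ + m)) ≡ a + m
    shift = solve-∀
    prev≤Z+n : diag (proj₁ (prev O)) ≤ diag Z + + n
    prev≤Z+n = subst (diag (proj₁ (prev O)) ≤_) (shift (diag Z) (+ n))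
                 (i<j⇒i≤pred[j] (<-≤-trans (step-increases-diag (prev-step O)) O≤Z+n))
  ...   | k , reached = k ℕ.+ 1 , trans (cong proj₁ (fold-+ O prev k)) reached

  visited-forward : ∀ Z → IsOne t Z → diag (proj₁ start) ≤ diag Z → ∃[ α ] (sequence α ≡ Z)
  visited-forward Z oneZ start≤Z with ≤⇒offset start≤Z
  ... | n , Z≡ with reach-forward n start Z oneZ start≤Z (≤-reflexive Z≡)
  ...   | k , reached = + k , reached

  visited-backward : ∀ Z → IsOne t Z → diag Z ≤ diag (proj₁ (prev start)) → ∃[ α ] (sequence α ≡ Z)
  visited-backward Z oneZ Z≤prev with ≤⇒offset Z≤prev
  ... | n , prev≡ with reach-backward n (prev start) Z oneZ Z≤prev (≤-reflexive prev≡)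
  ...   | k , reached = -[1+ k ] , reached

  every-one-visited : ∀ Z → IsOne t Z → ∃[ α ] (sequence α ≡ Z)
  every-one-visited Z oneZ with diag (proj₁ start) ≤? diag Z
  ... | yes start≤Z = visited-forward Z oneZ start≤Z
  ... | no  start≰Z = visited-backward Z oneZ (prev-nearest start Z oneZ (≰⇒> start≰Z))

  open StepSequence sequence sequence-step

  -- Property (iii): a one north-east of the position at index N is visited at some later
  -- index β, and between N and β the path must step both up and right.
  later-steps : ∀ N → (∃[ α ] (N ≤ α × TypeA sequence α)) × (∃[ β ] (N ≤ β × TypeB sequence β))
  later-steps N with proj₁ (enough (proj₁ (sequence N)) (proj₂ (sequence N)))
  ... | p , q , p<x , y<q , one with every-one-visited (p , q) one
  ...   | β , β↦ = map₂ (λ { (N≤α , _ , A) → N≤α , A }) (typeA-between (<⇒≤ N<β) up) ,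
                   map₂ (λ { (N≤α , _ , B) → N≤α , B }) (typeB-between (<⇒≤ N<β) right)
    where
    N<β : N < β
    N<β = diag-reflects (subst (λ Q → diag (sequence N) < diag Q) (sym β↦)
                               (+-mono-< y<q (neg-mono-< p<x)))
    up : proj₁ (sequence β) < proj₁ (sequence N)
    up = subst (λ Q → proj₁ Q < proj₁ (sequence N)) (sym β↦) p<x
    right : proj₂ (sequence N) < proj₂ (sequence β)
    right = subst (λ Q → proj₂ (sequence N) < proj₂ Q) (sym β↦) y<q

  earlier-steps : ∀ N → (∃[ α ] (α ≤ - N × TypeA sequence α)) × (∃[ β ] (β ≤ - N × TypeB sequence β))
  earlier-steps N with proj₂ (enough (proj₁ (sequence (- N))) (proj₂ (sequence (- N))))
  ... | p , q , x<p , q<y , one with every-one-visited (p , q) one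
  ...   | β , β↦ = map₂ (λ { (_ , α<-N , A) → <⇒≤ α<-N , A }) (typeA-between (<⇒≤ β<-N) up) ,
                   map₂ (λ { (_ , α<-N , B) → <⇒≤ α<-N , B }) (typeB-between (<⇒≤ β<-N) right)
    where
    β<-N : β < - N
    β<-N = diag-reflects (subst (λ Q → diag Q < diag (sequence (- N))) (sym β↦)
                                (+-mono-< q<y (neg-mono-< x<p)))
    up : proj₁ (sequence (- N)) < proj₁ (sequence β)
    up = subst (λ Q → proj₁ (sequence (- N)) < proj₁ Q) (sym β↦) x<p
    right : proj₂ (sequence β) < proj₂ (sequence (- N))
    right = subst (λ Q → proj₂ Q < proj₂ (sequence (- N))) (sym β↦) q<y

  is-ones-sequence : IsOnesSequence t sequence
  is-ones-sequence =
    (λ x y → mk⇔ (every-one-visited (x , y)) (λ { (α , α↦) → subst (IsOne t) α↦ (proj₂ (path α)) })) ,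
    sequence-step , later-steps , earlier-steps

ℤ-induction : (P : ℤ → Set) → P 0ℤ → (∀ a → P a → P (a + 1ℤ)) → (∀ a → P a → P (a - 1ℤ)) → ∀ a → P a
ℤ-induction P base up down (+ n) = upward n
  where
  upward : ∀ n → P (+ n)
  upward zero    = base
  upward (suc n) = subst P (cong +_ (ℕₚ.+-comm n 1)) (up (+ n) (upward n))
ℤ-induction P base up down -[1+ n ] = downward n
  where
  downward : ∀ n → P -[1+ n ]
  downward zero    = down 0ℤ base
  downward (suc n) =
    subst P (cong (λ m → -[1+ suc m ]) (ℕₚ.+-identityʳ n)) (down -[1+ n ] (downward n))

module OnesSequence {t : ℤ → ℤ → ℕ} {s : ℤ → Pos} (S : IsOnesSequence t s) where
  open StepSequence s (proj₁ (proj₂ S)) public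

  index : ∀ {P} → IsOne t P → ∃[ α ] (s α ≡ P)
  index {P} = Equivalence.to (proj₁ S (proj₁ P) (proj₂ P))

  is-one : ∀ α → IsOne t (s α)
  is-one α = Equivalence.from (proj₁ S (proj₁ (s α)) (proj₂ (s α))) (α , refl)

  next-nearest : ∀ α Z → IsOne t Z → diag (s α) < diag Z → diag (s (α + 1ℤ)) ≤ diag Z
  next-nearest α Z oneZ α<Z with index oneZ
  ... | β , refl = diag-monotone (subst (_≤ β) (+-comm 1ℤ α) (i<j⇒suc[i]≤j (diag-reflects α<Z)))

-- Uniqueness: two sequences with properties (i) and (ii) differ by a shift of index,
-- since both list the ones in increasing diagonal order.
module Uniqueness {t : ℤ → ℤ → ℕ} {s s′ : ℤ → Pos}
                  (S : IsOnesSequence t s) (S′ : IsOnesSequence t s′) where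
  open OnesSequence S
  module S′ = OnesSequence S′

  -- If s′ α = s γ then the next terms agree (both are the nearest one beyond), and so do
  -- the previous ones.
  shift-forward : ∀ {α γ} → s′ α ≡ s γ → s′ (α + 1ℤ) ≡ s (γ + 1ℤ)
  shift-forward {α} {γ} same with index (S′.is-one (α + 1ℤ))
  ... | β , β↦ = trans (sym β↦) (cong s (index-injective (≤-antisym β≤γ+1 γ+1≤β)))
    where
    β≤γ+1 : diag (s β) ≤ diag (s (γ + 1ℤ))
    β≤γ+1 = subst (λ Q → diag Q ≤ diag (s (γ + 1ℤ))) (sym β↦)
      (S′.next-nearest α (s (γ + 1ℤ)) (is-one (γ + 1ℤ))
        (subst (λ Q → diag Q < diag (s (γ + 1ℤ))) (sym same) (diag-increasing (i<i+1+n γ 0))))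
    γ+1≤β : diag (s (γ + 1ℤ)) ≤ diag (s β)
    γ+1≤β = subst (λ Q → diag (s (γ + 1ℤ)) ≤ diag Q) (sym β↦)
      (next-nearest γ (s′ (α + 1ℤ)) (S′.is-one (α + 1ℤ))
        (subst (λ Q → diag Q < diag (s′ (α + 1ℤ))) same (S′.diag-increasing (i<i+1+n α 0))))

  shift-backward : ∀ {α γ} → s′ α ≡ s γ → s′ (α - 1ℤ) ≡ s (γ - 1ℤ)
  shift-backward {α} {γ} same with index (S′.is-one (α - 1ℤ))
  ... | γ′ , γ′↦ = trans (sym γ′↦) (cong s γ′≡γ-1)
    where
    after : s′ α ≡ s (γ′ + 1ℤ)
    after = subst (λ a → s′ a ≡ s (γ′ + 1ℤ)) (minus-plus α 1ℤ) (shift-forward (sym γ′↦))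
    γ′≡γ-1 : γ′ ≡ γ - 1ℤ
    γ′≡γ-1 = trans (sym (plus-minus γ′ 1ℤ))
      (cong (_- 1ℤ) (index-injective (cong diag (trans (sym after) same))))

  shift-equivalence : ∃[ c ] (∀ α → s′ α ≡ s (α + c))
  shift-equivalence with index (S′.is-one 0ℤ)
  ... | c , c↦ = c , ℤ-induction (λ α → s′ α ≡ s (α + c)) base
        (λ α e → trans (shift-forward e) (cong s (swap+ α c)))
        (λ α e → trans (shift-backward e) (cong s (swap- α c)))
    where
    base : s′ 0ℤ ≡ s (0ℤ + c)
    base = trans (sym c↦) (cong s (sym (+-identityˡ c)))
    swap+ : ∀ α c → α + c + 1ℤ ≡ α + 1ℤ + c
    swap+ = solve-∀
    swap- : ∀ α c → α + c - 1ℤ ≡ α - 1ℤ + c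
    swap- = solve-∀

proposition8p2 : (t : ℤ → ℤ → ℕ) → IsSL2Tiling t → EnoughOnes t →
    (∃[ s ] IsOnesSequence t s) ×
    (∀ s s' → IsOnesSequence t s → IsOnesSequence t s' →
      ∃[ c ] (∀ α → s' α ≡ s (α + c)))
proposition8p2 t tiling enough =
  (Existence.sequence tiling enough , Existence.is-ones-sequence tiling enough) ,
  λ s s′ S S′ → Uniqueness.shift-equivalence S S′
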